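{- Let $0\le k\le d$ be integers. Every finite pure $d$-dimensional simplicial complex $X$ with $\tilde H_k(X)\neq 0$ has at least $\left\lceil \frac{(d+1)(k+2)}{k+1}\right\rceil$ vertices. Moreover, this bound is tight: there exists a pure $d$-dimensional simplicial complex with nontrivial $\tilde H_k$ having exactly $\left\lceil \frac{(d+1)(k+2)}{k+1}\right\rceil$ vertices.
   Context: A simplicial complex is pure $d$-dimensional if every simplex is contained in a $d$-dimensional face (so all maximal faces have dimension $d$). Homology is simplicial homology with coefficients in an arbitrary abelian group; $\tilde H_k$ denotes reduced homology. -}

module Defs where

open import Level using (Level; _⊔_) renaming (suc to lsuc)
open import Data.Nat using (ℕ; zero; suc; _+_; _*_; _<ᵇ_)
open import Data.Nat.DivMod using (_/_)
open import Data.Bool using (Bool; true; false)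
open import Data.Fin using (Fin; toℕ) renaming (zero to fzero; suc to fsuc)
open import Data.Fin.Subset using (Subset; _⊆_; _∪_; _∩_; ⁅_⁆; ∣_∣)
open import Data.Vec using (lookup; tabulate)
open import Data.Product using (Σ; ∃; _×_; _,_)
open import Relation.Nullary using (¬_)
open import Relation.Binary.PropositionalEquality using (_≡_)
open import Algebra.Bundles using (AbelianGroup)

-- A finite (abstract) simplicial complex on the vertex set Fin n:
-- a down-closed family of subsets (the empty face is allowed; it plays
-- the role of the (-1)-dimensional face, giving reduced homology).
record Complex (n : ℕ) : Set₁ where
  field
    face       : Subset n → Set
    downClosed : ∀ {σ τ} → τ ⊆ σ → face σ → face τ
open Complex public

Pure : ∀ {n} → ℕ → Complex n → Set
Pure {n} d X = ∀ σ → face X σ → Σ (Subset n) λ τ → face X τ × σ ⊆ τ × ∣ τ ∣ ≡ suc d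

-- ⌈ a / (b+1) ⌉ for natural numbers
ceilDiv : ℕ → ℕ → ℕ
ceilDiv a b = (a + b) / suc b

module Homology {c ℓ : Level} (G : AbelianGroup c ℓ) where
  open AbelianGroup G

  sumFin : ∀ {n} → (Fin n → Carrier) → Carrier
  sumFin {zero}  f = ε
  sumFin {suc n} f = f fzero ∙ sumFin (λ i → f (fsuc i))

  signed : ℕ → Carrier → Carrier
  signed zero    x = x
  signed (suc m) x = signed m x ⁻¹

  below : ∀ {n} → Fin n → Subset n → ℕ
  below v τ = ∣ τ ∩ tabulate (λ u → toℕ u <ᵇ toℕ v) ∣

  -- Chains with coefficients in G: functions on subsets, vanishing off X.
  -- A k-chain is read off on the faces with k+1 vertices.
  Chain : ∀ {n} → Complex n → Set (c ⊔ ℓ)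
  Chain {n} X = Σ (Subset n → Carrier) λ f → ∀ σ → ¬ face X σ → f σ ≈ ε

  -- simplicial boundary: ∂[v₀<…<v_{m}] = Σ (-1)^i [… v̂ᵢ …]
  ∂ : ∀ {n} → (Subset n → Carrier) → Subset n → Carrier
  ∂ f τ = sumFin (λ v → term v (lookup τ v))
    where
    term : _ → Bool → Carrier
    term v true  = ε
    term v false = signed (below v τ) (f (τ ∪ ⁅ v ⁆))

  -- reduced k-cycles and k-boundaries (the empty face gives augmentation)
  IsCycle : ∀ {n} (X : Complex n) → ℕ → Chain X → Set ℓ
  IsCycle X k (f , _) = ∀ τ → ∣ τ ∣ ≡ k → ∂ f τ ≈ ε

  IsBoundary : ∀ {n} (X : Complex n) → ℕ → Chain X → Set (c ⊔ ℓ)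
  IsBoundary X k (f , _) = ∃ λ (b : Chain X) → ∀ σ → ∣ σ ∣ ≡ suc k → f σ ≈ ∂ (Data.Product.proj₁ b) σ

  NontrivialH : ∀ {n} → Complex n → ℕ → Set (c ⊔ ℓ)
  NontrivialH X k = ∃ λ (z : Chain X) → IsCycle X k z × ¬ IsBoundary X k z

{-# OPTIONS --safe #-}
-- In a pure d-dimensional complex on n vertices every facet misses
-- m = n − (d+1) vertices, and n < ⌈(d+1)(k+2)/(k+1)⌉ forces (k+2)m < n.  Adding
-- facets one at a time, Mayer–Vietoris shows that a union of sets F ⊆ V, each
-- missing at most m points of V, has H̃_i = 0 whenever (i+2)m < |V|: one facet is a
-- cone, and the trace of a new facet F on the earlier ones is such a union inside F,
-- where |F| ≥ |V| − m > (i+1)m, so induction applies one degree lower.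
--
-- Cut N = ⌈(d+1)(k+2)/(k+1)⌉ vertices into k+2 blocks of at most
-- N − (d+1) vertices each, and take the sets of at most d+1 vertices that miss some
-- block.  This complex is pure of dimension d, and the boundary of the simplex
-- spanned by one vertex per block is a k-cycle that does not bound: collapsing every
-- block to a point maps the complex into the boundary of a (k+1)-simplex, which has
-- no (k+1)-faces, while the cycle maps to its fundamental cycle.

module Submission where

open import Defs
open import Level using (Level; _⊔_)
open import Function using (_∘_; _⇔_; mk⇔; Equivalence)
open import Data.Bool using (Bool; if_then_else_)
import Data.Bool.Properties as Boolᵖ
open import Data.Empty using (⊥-elim)
open import Data.Nat using (ℕ; zero; suc; _+_; _*_; _∸_; _⊓_; _≤_; _<_; _≤?_; _≟_; z≤n; s≤s)
open import Data.Nat.Properties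
open import Data.Nat.DivMod using (_%_; m≡m%n+[m/n]*n; m%n<n; m<n*o⇒m/o<n)
open import Data.Nat.Tactic.RingSolver using (solve-∀)
open import Data.Fin using (Fin; fromℕ) renaming (zero to fzero; suc to fsuc)
open import Data.Fin.Subset
  using (Subset; inside; outside; _⊆_; _∩_; _∪_; _─_; ⁅_⁆; ∣_∣; ⊥; ⊤)
open import Data.Fin.Subset.Properties
  using (⊆-refl; ⊆-trans; ⊆⊤; drop-∷-⊆; out⊆; s⊆s; _⊆?_; p⊆q⇒∣p∣≤∣q∣; ∣p∣≤n;
         ∣⊥∣≡0; ∣⊤∣≡n; p∩q⊆p; p∩q⊆q; x∈p∩q⁺; ∪-identityʳ)
open import Data.Vec.Base as Vec using ([]; _∷_; _++_; lookup; tabulate)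
open import Data.Vec.Properties using (≡-dec)
open import Data.List.Base as List using (List; []; _∷_; map; length; filter)
open import Data.Nat.ListAction using (sum)
open import Data.List.Relation.Unary.Any as Any using (Any; here; there; any?)
open import Data.List.Relation.Unary.Any.Properties using (map⁺; map⁻)
open import Data.List.Relation.Unary.All as All using (All; []; _∷_)
import Data.List.Relation.Unary.All.Properties as Allᵖ
open import Data.List.Membership.Propositional using (find; lose) renaming (_∈_ to _∈ₗ_)
open import Data.List.Membership.Propositional.Properties
  using (∈-++⁺ˡ; ∈-++⁺ʳ; ∈-map⁺; ∈-filter⁺; ∈-filter⁻)
open import Data.Product using (Σ; ∃; ∃₂; _×_; _,_; proj₁; proj₂)
open import Data.Sum using (_⊎_; inj₁; inj₂; [_,_])
open import Relation.Nullary using (¬_; ¬?; Dec; yes; no; does)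
open import Relation.Nullary.Decidable using (_×-dec_; ¬¬-excluded-middle)
open import Relation.Binary.Definitions using (DecidableEquality)
open import Relation.Unary using (Decidable)
open import Relation.Binary.PropositionalEquality
  using (_≡_; refl; sym; trans; cong; cong₂; subst; subst₂; module ≡-Reasoning)
open import Algebra.Bundles using (AbelianGroup)

-- Arithmetic of the bound

ceilDiv-least : ∀ a b n → a ≤ n * suc b → ceilDiv a b ≤ n
ceilDiv-least a b n a≤n[1+b] = ≤-pred (m<n*o⇒m/o<n (begin-strict
  a + b                 ≤⟨ +-monoˡ-≤ b a≤n[1+b] ⟩
  n * suc b + b         <⟨ n<1+n _ ⟩
  suc (n * suc b + b)   ≡⟨ cong suc (+-comm (n * suc b) b) ⟩
  suc n * suc b         ∎))
  where open ≤-Reasoning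

ceilDiv-spec : ∀ a b → a ≤ ceilDiv a b * suc b
ceilDiv-spec a b = +-cancelʳ-≤ b a (ceilDiv a b * suc b) (begin
  a + b                                  ≡⟨ m≡m%n+[m/n]*n (a + b) (suc b) ⟩
  (a + b) % suc b + ceilDiv a b * suc b  ≤⟨ +-monoˡ-≤ _ (≤-pred (m%n<n (a + b) (suc b))) ⟩
  b + ceilDiv a b * suc b                ≡⟨ +-comm b _ ⟩
  ceilDiv a b * suc b + b                ∎)
  where open ≤-Reasoning

[d+1][k+2]≡ : ∀ d k → (d + 1) * (k + 2) ≡ suc d * suc k + suc d
[d+1][k+2]≡ = solve-∀

[2+k]m≡m[1+k]+m : ∀ k m → suc (suc k) * m ≡ m * suc k + m
[2+k]m≡m[1+k]+m = solve-∀

small-codimension : ∀ d k m → (suc d + m) * suc k < (d + 1) * (k + 2) →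
                    suc (suc k) * m < suc d + m
small-codimension d k m lt = begin-strict
  suc (suc k) * m  ≡⟨ [2+k]m≡m[1+k]+m k m ⟩
  m * suc k + m    <⟨ +-monoˡ-< m m[1+k]<1+d ⟩
  suc d + m        ∎
  where
  open ≤-Reasoning
  m[1+k]<1+d : m * suc k < suc d
  m[1+k]<1+d = +-cancelˡ-< (suc d * suc k) _ _
    (subst₂ _<_ (*-distribʳ-+ (suc k) (suc d) m) ([d+1][k+2]≡ d k) lt)

facet-fits : ∀ d k N → (d + 1) * (k + 2) ≤ N * suc k → suc d ≤ N
facet-fits d k N bound = *-cancelʳ-≤ (suc d) N (suc k)
  (≤-trans (subst (suc d * suc k ≤_) (sym ([d+1][k+2]≡ d k)) (m≤m+n _ _)) bound)

excess-bound : ∀ d k x → (d + 1) * (k + 2) ≤ (suc d + x) * suc k → suc d ≤ x * suc k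
excess-bound d k x bound = +-cancelˡ-≤ (suc d * suc k) _ _ (begin
  suc d * suc k + suc d      ≡⟨ sym ([d+1][k+2]≡ d k) ⟩
  (d + 1) * (k + 2)          ≤⟨ bound ⟩
  (suc d + x) * suc k        ≡⟨ *-distribʳ-+ (suc k) (suc d) x ⟩
  suc d * suc k + x * suc k  ∎)
  where open ≤-Reasoning

vertex-split : ∀ d k N → k ≤ d → (d + 1) * (k + 2) ≤ N * suc k →
               ∃₂ λ e M → d ≡ k + e × N ≡ suc d + suc M × e ≤ M * suc k
vertex-split d k N k≤d bound
  with m≤n⇒∃[o]m+o≡n k≤d | m≤n⇒∃[o]m+o≡n (facet-fits d k N bound)
... | e , refl | suc M , refl =
  e , M , refl , refl , +-cancelˡ-≤ k e (M * suc k) (≤-pred (excess-bound (k + e) k (suc M) bound))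
... | e , refl | zero , refl with excess-bound (k + e) k zero bound
...   | ()

allSubsets : ∀ n → List (Subset n)
allSubsets zero    = [] ∷ []
allSubsets (suc n) = map (inside ∷_) (allSubsets n) List.++ map (outside ∷_) (allSubsets n)

∈-allSubsets : ∀ {n} (σ : Subset n) → σ ∈ₗ allSubsets n
∈-allSubsets []            = here refl
∈-allSubsets (inside ∷ σ)  = ∈-++⁺ˡ (∈-map⁺ (inside ∷_) (∈-allSubsets σ))
∈-allSubsets (outside ∷ σ) =
  ∈-++⁺ʳ (map (inside ∷_) (allSubsets _)) (∈-map⁺ (outside ∷_) (∈-allSubsets σ))

¬¬-decidable : ∀ {n p} (P : Subset n → Set p) → ¬ ¬ (∀ σ → Dec (P σ))
¬¬-decidable {zero} P ¬dec = ¬¬-excluded-middle λ P[]? → ¬dec λ { [] → P[]? }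
¬¬-decidable {suc n} P ¬dec =
  ¬¬-decidable (P ∘ (inside ∷_)) λ P-inside? →
  ¬¬-decidable (P ∘ (outside ∷_)) λ P-outside? →
  ¬dec λ { (inside ∷ σ) → P-inside? σ ; (outside ∷ σ) → P-outside? σ }

_≟ˢ_ : ∀ {n} → DecidableEquality (Subset n)
_≟ˢ_ = ≡-dec Boolᵖ._≟_

_⋖_ : ∀ {n} → Subset n → Subset n → Set
τ ⋖ σ = τ ⊆ σ × ∣ σ ∣ ≡ suc ∣ τ ∣

∣p∣≡0⇒p⊆q : ∀ {n} {p q : Subset n} → ∣ p ∣ ≡ 0 → p ⊆ q
∣p∣≡0⇒p⊆q {p = []}          {[]}    _      = ⊆-refl
∣p∣≡0⇒p⊆q {p = outside ∷ p} {_ ∷ q} ∣p∣≡0 = out⊆ (∣p∣≡0⇒p⊆q ∣p∣≡0)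

∣p++q∣≡∣p∣+∣q∣ : ∀ {m n} (p : Subset m) (q : Subset n) → ∣ p ++ q ∣ ≡ ∣ p ∣ + ∣ q ∣
∣p++q∣≡∣p∣+∣q∣ []            q = refl
∣p++q∣≡∣p∣+∣q∣ (inside ∷ p)  q = cong suc (∣p++q∣≡∣p∣+∣q∣ p q)
∣p++q∣≡∣p∣+∣q∣ (outside ∷ p) q = ∣p++q∣≡∣p∣+∣q∣ p q

∣p∩tabulate-outside∣≡0 : ∀ {n} (p : Subset n) → ∣ p ∩ tabulate (λ _ → outside) ∣ ≡ 0
∣p∩tabulate-outside∣≡0 []            = refl
∣p∩tabulate-outside∣≡0 (inside ∷ p)  = ∣p∩tabulate-outside∣≡0 p
∣p∩tabulate-outside∣≡0 (outside ∷ p) = ∣p∩tabulate-outside∣≡0 p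

inside⊈outside : ∀ {n} {p q : Subset n} → ¬ (inside ∷ p ⊆ outside ∷ q)
inside⊈outside p⊆q with p⊆q Vec.here
... | ()

∣p∣≡∣q∣+∣p─q∣ : ∀ {n} {p q : Subset n} → q ⊆ p → ∣ p ∣ ≡ ∣ q ∣ + ∣ p ─ q ∣
∣p∣≡∣q∣+∣p─q∣ {p = []}          {[]}          _   = refl
∣p∣≡∣q∣+∣p─q∣ {p = inside ∷ p}  {inside ∷ q}  q⊆p = cong suc (∣p∣≡∣q∣+∣p─q∣ (drop-∷-⊆ q⊆p))
∣p∣≡∣q∣+∣p─q∣ {p = inside ∷ p}  {outside ∷ q} q⊆p =
  trans (cong suc (∣p∣≡∣q∣+∣p─q∣ (drop-∷-⊆ q⊆p))) (sym (+-suc _ _))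
∣p∣≡∣q∣+∣p─q∣ {p = outside ∷ p} {outside ∷ q} q⊆p = ∣p∣≡∣q∣+∣p─q∣ (drop-∷-⊆ q⊆p)
∣p∣≡∣q∣+∣p─q∣ {p = outside ∷ p} {inside ∷ q}  q⊆p = ⊥-elim (inside⊈outside q⊆p)

p─[p∩q]⊆r─q : ∀ {n} {p q r : Subset n} → p ⊆ r → p ─ (p ∩ q) ⊆ r ─ q
p─[p∩q]⊆r─q {p = outside ∷ _} {_ ∷ _}       {_ ∷ _}       p⊆r (Vec.there x∈) =
  Vec.there (p─[p∩q]⊆r─q (drop-∷-⊆ p⊆r) x∈)
p─[p∩q]⊆r─q {p = inside ∷ _}  {inside ∷ _}  {_ ∷ _}       p⊆r (Vec.there x∈) =
  Vec.there (p─[p∩q]⊆r─q (drop-∷-⊆ p⊆r) x∈)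
p─[p∩q]⊆r─q {p = inside ∷ _}  {outside ∷ _} {inside ∷ _}  p⊆r Vec.here = Vec.here
p─[p∩q]⊆r─q {p = inside ∷ _}  {outside ∷ _} {inside ∷ _}  p⊆r (Vec.there x∈) =
  Vec.there (p─[p∩q]⊆r─q (drop-∷-⊆ p⊆r) x∈)
p─[p∩q]⊆r─q {p = inside ∷ _}  {outside ∷ _} {outside ∷ _} p⊆r _ = ⊥-elim (inside⊈outside p⊆r)

⊆-extend : ∀ {n} {σ W : Subset n} D → σ ⊆ W → ∣ σ ∣ ≤ D → D ≤ ∣ W ∣ →
           ∃ λ τ → σ ⊆ τ × τ ⊆ W × ∣ τ ∣ ≡ D
⊆-extend {σ = []} {[]} zero _ _ _ = [] , ⊆-refl , ⊆-refl , refl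
⊆-extend {σ = outside ∷ σ} {outside ∷ W} D σ⊆W σ≤D D≤W
  with τ , σ⊆τ , τ⊆W , ∣τ∣≡D ← ⊆-extend D (drop-∷-⊆ σ⊆W) σ≤D D≤W =
  outside ∷ τ , s⊆s σ⊆τ , s⊆s τ⊆W , ∣τ∣≡D
⊆-extend {σ = inside ∷ σ} {inside ∷ W} (suc D) σ⊆W (s≤s σ≤D) (s≤s D≤W)
  with τ , σ⊆τ , τ⊆W , ∣τ∣≡D ← ⊆-extend D (drop-∷-⊆ σ⊆W) σ≤D D≤W =
  inside ∷ τ , s⊆s σ⊆τ , s⊆s τ⊆W , cong suc ∣τ∣≡D
⊆-extend {σ = outside ∷ σ} {inside ∷ W} D σ⊆W σ≤D D≤1+W with D ≤? ∣ W ∣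
... | yes D≤W with τ , σ⊆τ , τ⊆W , ∣τ∣≡D ← ⊆-extend D (drop-∷-⊆ σ⊆W) σ≤D D≤W =
  outside ∷ τ , s⊆s σ⊆τ , out⊆ τ⊆W , ∣τ∣≡D
... | no D≰W = inside ∷ W , out⊆ (drop-∷-⊆ σ⊆W) , ⊆-refl , ≤-antisym (≰⇒> D≰W) D≤1+W
⊆-extend {σ = inside ∷ σ} {outside ∷ W} D σ⊆W _ _ = ⊥-elim (inside⊈outside σ⊆W)

MissesAtMost : ∀ {n} → ℕ → Subset n → Subset n → Set
MissesAtMost m V F = F ⊆ V × ∣ V ─ F ∣ ≤ m

MissesAtMost⇒< : ∀ {n m x} {V F : Subset n} → MissesAtMost m V F → m + x < ∣ V ∣ → x < ∣ F ∣
MissesAtMost⇒< {m = m} {x} {V} {F} (F⊆V , ∣V─F∣≤m) m+x<∣V∣ = +-cancelʳ-< m x ∣ F ∣ (begin-strict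
  x + m              ≡⟨ +-comm x m ⟩
  m + x              <⟨ m+x<∣V∣ ⟩
  ∣ V ∣              ≡⟨ ∣p∣≡∣q∣+∣p─q∣ F⊆V ⟩
  ∣ F ∣ + ∣ V ─ F ∣  ≤⟨ +-monoʳ-≤ ∣ F ∣ ∣V─F∣≤m ⟩
  ∣ F ∣ + m          ∎)
  where open ≤-Reasoning

MissesAtMost-∩ : ∀ {n m} {V F F′ : Subset n} →
                 MissesAtMost m V F → MissesAtMost m V F′ → MissesAtMost m F (F ∩ F′)
MissesAtMost-∩ {V = V} {F} {F′} (F⊆V , _) (_ , ∣V─F′∣≤m) =
  p∩q⊆p F F′ , ≤-trans (p⊆q⇒∣p∣≤∣q∣ (p─[p∩q]⊆r─q {q = F′} {V} F⊆V)) ∣V─F′∣≤m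

MissesAtMost-⊤ : ∀ {n D} {F : Subset n} → ∣ F ∣ ≡ D → MissesAtMost (n ∸ D) ⊤ F
MissesAtMost-⊤ {n} {D} {F} refl = ⊆⊤ , ≤-reflexive (begin
  ∣ ⊤ ─ F ∣                    ≡⟨ sym (m+n∸m≡n ∣ F ∣ _) ⟩
  ∣ F ∣ + ∣ ⊤ ─ F ∣ ∸ ∣ F ∣    ≡⟨ cong (_∸ ∣ F ∣) (sym (∣p∣≡∣q∣+∣p─q∣ {p = ⊤} {F} ⊆⊤)) ⟩
  ∣ ⊤ {n} ∣ ∸ ∣ F ∣            ≡⟨ cong (_∸ ∣ F ∣) (∣⊤∣≡n n) ⟩
  n ∸ ∣ F ∣                    ∎)
  where open ≡-Reasoning

-- Complexes generated by facets

Generated : ∀ {n} → List (Subset n) → Subset n → Set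
Generated Fs σ = Any (σ ⊆_) Fs

Generated-downClosed : ∀ {n} {Fs : List (Subset n)} {σ τ} → τ ⊆ σ → Generated Fs σ → Generated Fs τ
Generated-downClosed τ⊆σ = Any.map (⊆-trans τ⊆σ)

Generated-∷ : ∀ {n} {F : Subset n} {Fs σ} → (σ ⊆ F ⊎ Generated Fs σ) ⇔ Generated (F ∷ Fs) σ
Generated-∷ = mk⇔ [ here , there ] λ { (here σ⊆F) → inj₁ σ⊆F ; (there gen) → inj₂ gen }

generated? : ∀ {n} (Fs : List (Subset n)) → Decidable (Generated Fs)
generated? Fs σ = any? (σ ⊆?_) Fs

Generated-map : ∀ {m n n′} {f : Subset m → Subset n} {g : Subset m → Subset n′} {Ws σ σ′} →
                (∀ {W} → σ ⊆ f W → σ′ ⊆ g W) → Generated (map f Ws) σ → Generated (map g Ws) σ′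
Generated-map h = map⁺ ∘ Any.map h ∘ map⁻

Generated-map-∩ : ∀ {n} (F : Subset n) Fs {σ} → Generated (map (F ∩_) Fs) σ ⇔ (σ ⊆ F × Generated Fs σ)
Generated-map-∩ F Fs {σ} = mk⇔ to from
  where
  ⊆∩⇒⊆ʳ : ∀ {F′} → σ ⊆ F ∩ F′ → σ ⊆ F′
  ⊆∩⇒⊆ʳ {F′} σ⊆F∩F′ = ⊆-trans σ⊆F∩F′ (p∩q⊆q F F′)
  ⊆⇒⊆∩ : σ ⊆ F → ∀ {F′} → σ ⊆ F′ → σ ⊆ F ∩ F′
  ⊆⇒⊆∩ σ⊆F σ⊆F′ x∈σ = x∈p∩q⁺ (σ⊆F x∈σ , σ⊆F′ x∈σ)
  to : Generated (map (F ∩_) Fs) σ → σ ⊆ F × Generated Fs σ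
  to gen with F′ , σ⊆F∩F′ ← Any.satisfied (map⁻ gen) =
    ⊆-trans σ⊆F∩F′ (p∩q⊆p F F′) , Any.map ⊆∩⇒⊆ʳ (map⁻ gen)
  from : σ ⊆ F × Generated Fs σ → Generated (map (F ∩_) Fs) σ
  from (σ⊆F , gen) = map⁺ (Any.map (⊆⇒⊆∩ σ⊆F) gen)

facet? : ∀ {n} (X : Complex n) → (∀ σ → Dec (face X σ)) → ∀ D → Decidable (λ σ → face X σ × ∣ σ ∣ ≡ D)
facet? X face? D σ = face? σ ×-dec (∣ σ ∣ ≟ D)

facets : ∀ {n} (X : Complex n) → (∀ σ → Dec (face X σ)) → ℕ → List (Subset n)
facets X face? D = filter (facet? X face? D) (allSubsets _)

facets-generate : ∀ {n d} (X : Complex n) (face? : ∀ σ → Dec (face X σ)) → Pure d X →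
                  ∀ {σ} → Generated (facets X face? (suc d)) σ ⇔ face X σ
facets-generate {d = d} X face? pure {σ} = mk⇔ from to
  where
  to : face X σ → Generated (facets X face? (suc d)) σ
  to σ∈X with τ , τ∈X , σ⊆τ , ∣τ∣≡ ← pure σ σ∈X =
    lose (∈-filter⁺ (facet? X face? (suc d)) (∈-allSubsets τ) (τ∈X , ∣τ∣≡)) σ⊆τ
  from : Generated (facets X face? (suc d)) σ → face X σ
  from gen with F , F∈ , σ⊆F ← find gen =
    downClosed X σ⊆F (proj₁ (proj₂ (∈-filter⁻ (facet? X face? (suc d)) {xs = allSubsets _} F∈)))

facets-size : ∀ {n} (X : Complex n) face? D → All (λ F → ∣ F ∣ ≡ D) (facets X face? D)
facets-size X face? D = All.map proj₂ (Allᵖ.all-filter (facet? X face? D) (allSubsets _))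

-- Block complexes

balanced-list : ∀ c M S → S ≤ c * M → Σ (List ℕ) λ as → length as ≡ c × All (_≤ M) as × sum as ≡ S
balanced-list zero    M S S≤0 = [] , refl , [] , sym (n≤0⇒n≡0 S≤0)
balanced-list (suc c) M S S≤[1+c]M
  with as , len , as≤M , sum≡ ← balanced-list c M (S ∸ M) (m≤n+o⇒m∸n≤o S M S≤[1+c]M) =
  M ⊓ S ∷ as , cong suc len , m⊓n≤m M S ∷ as≤M , trans (cong (M ⊓ S +_) sum≡) (m⊓n+n∸m≡n M S)

total : List ℕ → ℕ
total as = sum (map suc as)

total≡length+sum : ∀ as → total as ≡ length as + sum as
total≡length+sum []       = refl
total≡length+sum (a ∷ as) = cong suc (begin
  a + total as                ≡⟨ cong (a +_) (total≡length+sum as) ⟩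
  a + (length as + sum as)    ≡⟨ +-comm a _ ⟩
  length as + sum as + a      ≡⟨ +-assoc (length as) _ a ⟩
  length as + (sum as + a)    ≡⟨ cong (length as +_) (+-comm (sum as) a) ⟩
  length as + (a + sum as)    ∎)
  where open ≡-Reasoning

-- The vertices are cut into consecutive blocks, of sizes suc a for a ∈ as.  A face
-- of BlockComplex D as is a set of at most D vertices missing some block entirely:
-- the pull-back of the boundary of a simplex with one vertex per block, truncated.
avoiders : ∀ as → List (Subset (total as))
avoiders []       = []
avoiders (a ∷ as) = (⊥ {suc a} ++ ⊤) ∷ map (⊤ {suc a} ++_) (avoiders as)

BlockComplex : ℕ → ∀ as → Complex (total as)
BlockComplex D as = record
  { face       = λ σ → ∣ σ ∣ ≤ D × Generated (avoiders as) σ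
  ; downClosed = λ τ⊆σ (∣σ∣≤D , σ∈) → ≤-trans (p⊆q⇒∣p∣≤∣q∣ τ⊆σ) ∣σ∣≤D , Generated-downClosed τ⊆σ σ∈
  }

-- The last vertex of each block, so that it stays fixed when the first vertex of a
-- larger block is collapsed onto the next one (see collapse).
transversal : ∀ as → Subset (total as)
transversal []       = []
transversal (a ∷ as) = ⁅ fromℕ a ⁆ ++ transversal as

∣transversal∣ : ∀ as → ∣ transversal as ∣ ≡ length as
∣transversal∣ []       = refl
∣transversal∣ (a ∷ as) = trans (∣⁅fromℕ⁆++p∣ a) (cong suc (∣transversal∣ as))
  where
  ∣⁅fromℕ⁆++p∣ : ∀ a → ∣ ⁅ fromℕ a ⁆ ++ transversal as ∣ ≡ suc ∣ transversal as ∣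
  ∣⁅fromℕ⁆++p∣ zero    = refl
  ∣⁅fromℕ⁆++p∣ (suc a) = ∣⁅fromℕ⁆++p∣ a

avoiders-large : ∀ {M} as → All (_≤ M) as → All (λ W → total as ≤ ∣ W ∣ + suc M) (avoiders as)
avoiders-large []                    []           = []
avoiders-large {M} (a ∷ as) (a≤M ∷ as≤M) =
  first ∷ Allᵖ.map⁺ (All.map rest (avoiders-large as as≤M))
  where
  open ≤-Reasoning
  first : suc a + total as ≤ ∣ ⊥ {suc a} ++ ⊤ {total as} ∣ + suc M
  first = begin
    suc a + total as                       ≤⟨ +-monoˡ-≤ (total as) (s≤s a≤M) ⟩
    suc M + total as                       ≡⟨ +-comm (suc M) _ ⟩
    total as + suc M                       ≡⟨ cong (_+ suc M) ∣⊥++⊤∣ ⟨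
    ∣ ⊥ {suc a} ++ ⊤ {total as} ∣ + suc M  ∎
    where
    ∣⊥++⊤∣ : ∣ ⊥ {suc a} ++ ⊤ {total as} ∣ ≡ total as
    ∣⊥++⊤∣ = trans (∣p++q∣≡∣p∣+∣q∣ (⊥ {suc a}) (⊤ {total as}))
               (cong₂ _+_ (∣⊥∣≡0 (suc a)) (∣⊤∣≡n (total as)))
  rest : ∀ {W} → total as ≤ ∣ W ∣ + suc M → suc a + total as ≤ ∣ ⊤ {suc a} ++ W ∣ + suc M
  rest {W} total≤ = begin
    suc a + total as            ≤⟨ +-monoʳ-≤ (suc a) total≤ ⟩
    suc a + (∣ W ∣ + suc M)     ≡⟨ +-assoc (suc a) _ _ ⟨
    suc a + ∣ W ∣ + suc M       ≡⟨ cong (_+ suc M) ∣⊤++W∣ ⟨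
    ∣ ⊤ {suc a} ++ W ∣ + suc M  ∎
    where
    ∣⊤++W∣ : ∣ ⊤ {suc a} ++ W ∣ ≡ suc a + ∣ W ∣
    ∣⊤++W∣ = trans (∣p++q∣≡∣p∣+∣q∣ (⊤ {suc a}) W) (cong (_+ ∣ W ∣) (∣⊤∣≡n (suc a)))

block-partition : ∀ d k N → k ≤ d → (d + 1) * (k + 2) ≤ N * suc k →
                  Σ (List ℕ) λ as → length as ≡ suc (suc k) × total as ≡ N ×
                                    All (λ W → suc d ≤ ∣ W ∣) (avoiders as)
block-partition d k N k≤d bound
  with e , M , refl , refl , e≤M[1+k] ← vertex-split d k N k≤d bound
  with as , len , as≤M , sum≡ ← balanced-list (suc (suc k)) M (e + M)
         (≤-trans (+-monoˡ-≤ M e≤M[1+k]) (≤-reflexive (sym ([2+k]m≡m[1+k]+m k M)))) =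
  as , len , total≡ , All.map (λ {W} → fits W) (avoiders-large as as≤M)
  where
  total≡ : total as ≡ suc (k + e) + suc M
  total≡ = begin
    total as                     ≡⟨ total≡length+sum as ⟩
    length as + sum as           ≡⟨ cong₂ _+_ len sum≡ ⟩
    suc (suc k) + (e + M)        ≡⟨ lemma k e M ⟩
    suc (k + e) + suc M          ∎
    where
    open ≡-Reasoning
    lemma : ∀ k e M → suc (suc k) + (e + M) ≡ suc (k + e) + suc M
    lemma = solve-∀
  fits : ∀ W → total as ≤ ∣ W ∣ + suc M → suc (k + e) ≤ ∣ W ∣
  fits W total≤ = +-cancelʳ-≤ (suc M) _ ∣ W ∣ (subst (_≤ ∣ W ∣ + suc M) total≡ total≤)

block-complex-pure : ∀ {d} as → All (λ W → suc d ≤ ∣ W ∣) (avoiders as) →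
                     Pure d (BlockComplex (suc d) as)
block-complex-pure {d} as large σ (∣σ∣≤ , σ∈)
  with W , W∈ , σ⊆W ← find σ∈
  with τ , σ⊆τ , τ⊆W , ∣τ∣≡ ← ⊆-extend (suc d) σ⊆W ∣σ∣≤ (All.lookup large W∈) =
  τ , (≤-reflexive ∣τ∣≡ , lose W∈ τ⊆W) , σ⊆τ , ∣τ∣≡

Generated-avoiders-outside : ∀ {a as σ} → Generated (avoiders (a ∷ as)) σ →
                             Generated (avoiders (suc a ∷ as)) (outside ∷ σ)
Generated-avoiders-outside (here σ⊆W)  = here (s⊆s σ⊆W)
Generated-avoiders-outside (there σ∈) = there (Generated-map out⊆ σ∈)

Generated-avoiders-tail : ∀ {a as x σ} → Generated (avoiders (suc a ∷ as)) (x ∷ σ) →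
                          Generated (avoiders (a ∷ as)) σ
Generated-avoiders-tail (here xσ⊆W) = here (drop-∷-⊆ xσ⊆W)
Generated-avoiders-tail (there xσ∈) = there (Generated-map drop-∷-⊆ xσ∈)

Generated-avoiders-merge : ∀ {a as σ} → Generated (avoiders (suc a ∷ as)) (inside ∷ outside ∷ σ) →
                           Generated (avoiders (a ∷ as)) (inside ∷ σ)
Generated-avoiders-merge (here ⊆W)  = ⊥-elim (inside⊈outside ⊆W)
Generated-avoiders-merge (there ∈) = there (Generated-map (λ ⊆W → s⊆s (drop-∷-⊆ (drop-∷-⊆ ⊆W))) ∈)

Generated-avoiders-link : ∀ {as σ} →
                          Generated (avoiders (0 ∷ as)) (inside ∷ σ) ⇔ Generated (avoiders as) σ
Generated-avoiders-link = mk⇔ to from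
  where
  to : ∀ {as σ} → Generated (avoiders (0 ∷ as)) (inside ∷ σ) → Generated (avoiders as) σ
  to (here ⊆W)  = ⊥-elim (inside⊈outside ⊆W)
  to (there σ∈) = Any.map drop-∷-⊆ (map⁻ σ∈)
  from : ∀ {as σ} → Generated (avoiders as) σ → Generated (avoiders (0 ∷ as)) (inside ∷ σ)
  from σ∈ = there (map⁺ (Any.map s⊆s σ∈))

transversal-faces : ∀ a as {τ} → τ ⋖ transversal (a ∷ as) → Generated (avoiders (a ∷ as)) τ
transversal-faces (suc a) as {outside ∷ τ} (τ⊆T , ∣T∣≡) =
  Generated-avoiders-outside (transversal-faces a as (drop-∷-⊆ τ⊆T , ∣T∣≡))
transversal-faces (suc a) as {inside ∷ τ} (τ⊆T , _) = ⊥-elim (inside⊈outside τ⊆T)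
transversal-faces zero as {outside ∷ τ} _ = here (s⊆s ⊆⊤)
transversal-faces zero (a ∷ as) {inside ∷ τ} (τ⊆T , ∣T∣≡) =
  Equivalence.from Generated-avoiders-link (transversal-faces a as (drop-∷-⊆ τ⊆T , suc-injective ∣T∣≡))
transversal-faces zero [] {inside ∷ []} (_ , ())

-- Chains with coefficients in G

module _ {c ℓ : Level} (G : AbelianGroup c ℓ) where
  open AbelianGroup G renaming (refl to ≈-refl; sym to ≈-sym; trans to ≈-trans; reflexive to ≈-reflexive)
  open Homology G
  open import Algebra.Properties.AbelianGroup G
    using (ε⁻¹≈ε; ⁻¹-involutive; ⁻¹-injective; inverseˡ-unique; ⁻¹-∙-comm)
  open import Algebra.Properties.CommutativeSemigroup
    (Algebra.Bundles.CommutativeMonoid.commutativeSemigroup commutativeMonoid) using (interchange)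
  open import Relation.Binary.Reasoning.Setoid setoid

  ≈ε-∙ : ∀ {x y} → x ≈ ε → y ≈ ε → x ∙ y ≈ ε
  ≈ε-∙ x≈ε y≈ε = ≈-trans (∙-cong x≈ε y≈ε) (identityʳ ε)

  ≈ε-⁻¹ : ∀ {x} → x ≈ ε → x ⁻¹ ≈ ε
  ≈ε-⁻¹ x≈ε = ≈-trans (⁻¹-cong x≈ε) ε⁻¹≈ε

  Supported : ∀ {n} → (Subset n → Set) → (Subset n → Carrier) → Set ℓ
  Supported P f = ∀ σ → ¬ P σ → f σ ≈ ε

  Homogeneous : ∀ {n} → ℕ → (Subset n → Carrier) → Set ℓ
  Homogeneous j = Supported (λ σ → ∣ σ ∣ ≡ j)

  -- ∂ of Defs by recursion on the first vertex: if τ omits it, the summand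
  -- f (τ ∪ {first vertex}) has sign +1 and the others are as for the remaining
  -- vertices; if τ contains it, every other vertex has one more smaller vertex in τ,
  -- so all signs flip.
  ∂ʳ : ∀ {n} → (Subset n → Carrier) → Subset n → Carrier
  ∂ʳ f []            = ε
  ∂ʳ f (outside ∷ τ) = f (inside ∷ τ) ∙ ∂ʳ (f ∘ (outside ∷_)) τ
  ∂ʳ f (inside ∷ τ)  = ∂ʳ (f ∘ (inside ∷_)) τ ⁻¹

  Closed : ∀ {n} → (Subset n → Carrier) → Set ℓ
  Closed f = ∀ τ → ∂ʳ f τ ≈ ε

  sumFin-cong : ∀ {n} {f g : Fin n → Carrier} → (∀ i → f i ≈ g i) → sumFin f ≈ sumFin g
  sumFin-cong {zero}  f≈g = ≈-refl
  sumFin-cong {suc n} f≈g = ∙-cong (f≈g fzero) (sumFin-cong (f≈g ∘ fsuc))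

  sumFin-⁻¹ : ∀ {n} (f : Fin n → Carrier) → sumFin (λ i → f i ⁻¹) ≈ sumFin f ⁻¹
  sumFin-⁻¹ {zero}  f = ≈-sym ε⁻¹≈ε
  sumFin-⁻¹ {suc n} f = ≈-trans (∙-congˡ (sumFin-⁻¹ (f ∘ fsuc))) (⁻¹-∙-comm _ _)

  ∂-summand : ∀ {n} → (Subset n → Carrier) → Subset n → Fin n → Bool → Carrier
  ∂-summand f τ v inside  = ε
  ∂-summand f τ v outside = signed (below v τ) (f (τ ∪ ⁅ v ⁆))

  ∂≈sumFin : ∀ {n} (f : Subset n → Carrier) τ → ∂ f τ ≈ sumFin (λ v → ∂-summand f τ v (lookup τ v))
  ∂≈sumFin {n} f τ =
    ≈-trans (≈-reflexive (sym (proj₂ ∂-as-sumFin))) (sumFin-cong (≈-reflexive ∘ summand≡))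
    where
    -- The summands of ∂ are local to its where block; unification names them.
    ∂-as-sumFin : Σ (Fin n → Carrier) λ t → sumFin t ≡ ∂ f τ
    ∂-as-sumFin = _ , refl
    summand≡ : ∀ v → proj₁ ∂-as-sumFin v ≡ ∂-summand f τ v (lookup τ v)
    summand≡ v with lookup τ v
    ... | inside  = refl
    ... | outside = refl

  sumFin-∂-summand : ∀ {n} (f : Subset n → Carrier) τ →
                     sumFin (λ v → ∂-summand f τ v (lookup τ v)) ≈ ∂ʳ f τ
  sumFin-∂-summand f [] = ≈-refl
  sumFin-∂-summand f (outside ∷ τ) =
    ∙-cong first (≈-trans (sumFin-cong rest) (sumFin-∂-summand (f ∘ (outside ∷_)) τ))
    where
    first : ∂-summand f (outside ∷ τ) fzero outside ≈ f (inside ∷ τ)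
    first rewrite ∣p∩tabulate-outside∣≡0 τ | ∪-identityʳ τ = ≈-refl
    rest : ∀ v → ∂-summand f (outside ∷ τ) (fsuc v) (lookup τ v)
               ≈ ∂-summand (f ∘ (outside ∷_)) τ v (lookup τ v)
    rest v with lookup τ v
    ... | inside  = ≈-refl
    ... | outside = ≈-refl
  sumFin-∂-summand f (inside ∷ τ) = ≈-trans (identityˡ _) (≈-trans (sumFin-cong rest)
    (≈-trans (sumFin-⁻¹ summand↑) (⁻¹-cong (sumFin-∂-summand (f ∘ (inside ∷_)) τ))))
    where
    summand↑ : Fin _ → Carrier
    summand↑ v = ∂-summand (f ∘ (inside ∷_)) τ v (lookup τ v)
    rest : ∀ v → ∂-summand f (inside ∷ τ) (fsuc v) (lookup τ v) ≈ summand↑ v ⁻¹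
    rest v with lookup τ v
    ... | inside  = ≈-sym ε⁻¹≈ε
    ... | outside = ≈-refl

  ∂≈∂ʳ : ∀ {n} (f : Subset n → Carrier) τ → ∂ f τ ≈ ∂ʳ f τ
  ∂≈∂ʳ f τ = ≈-trans (∂≈sumFin f τ) (sumFin-∂-summand f τ)

  ∂ʳ-cong : ∀ {n} {f g : Subset n → Carrier} τ → (∀ σ → τ ⋖ σ → f σ ≈ g σ) → ∂ʳ f τ ≈ ∂ʳ g τ
  ∂ʳ-cong []            f≈g = ≈-refl
  ∂ʳ-cong (outside ∷ τ) f≈g = ∙-cong (f≈g (inside ∷ τ) (out⊆ ⊆-refl , refl))
    (∂ʳ-cong τ λ σ (τ⊆σ , ∣σ∣≡) → f≈g (outside ∷ σ) (s⊆s τ⊆σ , ∣σ∣≡))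
  ∂ʳ-cong (inside ∷ τ)  f≈g = ⁻¹-cong
    (∂ʳ-cong τ λ σ (τ⊆σ , ∣σ∣≡) → f≈g (inside ∷ σ) (s⊆s τ⊆σ , cong suc ∣σ∣≡))

  ∂ʳ-ε : ∀ {n} (τ : Subset n) → ∂ʳ (λ _ → ε) τ ≈ ε
  ∂ʳ-ε []            = ≈-refl
  ∂ʳ-ε (outside ∷ τ) = ≈-trans (identityˡ _) (∂ʳ-ε τ)
  ∂ʳ-ε (inside ∷ τ)  = ≈ε-⁻¹ (∂ʳ-ε τ)

  ∂ʳ-vanishes : ∀ {n} {f : Subset n → Carrier} τ → (∀ σ → τ ⋖ σ → f σ ≈ ε) → ∂ʳ f τ ≈ ε
  ∂ʳ-vanishes τ f≈ε = ≈-trans (∂ʳ-cong τ f≈ε) (∂ʳ-ε τ)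

  ∂ʳ-∙ : ∀ {n} (f g : Subset n → Carrier) τ → ∂ʳ (λ σ → f σ ∙ g σ) τ ≈ ∂ʳ f τ ∙ ∂ʳ g τ
  ∂ʳ-∙ f g []            = ≈-sym (identityʳ ε)
  ∂ʳ-∙ f g (outside ∷ τ) = ≈-trans (∙-congˡ (∂ʳ-∙ _ _ τ)) (interchange _ _ _ _)
  ∂ʳ-∙ f g (inside ∷ τ)  = ≈-trans (⁻¹-cong (∂ʳ-∙ _ _ τ)) (≈-sym (⁻¹-∙-comm _ _))

  ∂ʳ-⁻¹ : ∀ {n} (f : Subset n → Carrier) τ → ∂ʳ (λ σ → f σ ⁻¹) τ ≈ ∂ʳ f τ ⁻¹
  ∂ʳ-⁻¹ f []            = ≈-sym ε⁻¹≈ε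
  ∂ʳ-⁻¹ f (outside ∷ τ) = ≈-trans (∙-congˡ (∂ʳ-⁻¹ _ τ)) (⁻¹-∙-comm _ _)
  ∂ʳ-⁻¹ f (inside ∷ τ)  = ⁻¹-cong (∂ʳ-⁻¹ _ τ)

  ∂ʳ∘∂ʳ : ∀ {n} (f : Subset n → Carrier) → Closed (∂ʳ f)
  ∂ʳ∘∂ʳ f []            = ≈-refl
  ∂ʳ∘∂ʳ f (outside ∷ τ) = begin
    ∂ʳ f↑ τ ⁻¹ ∙ ∂ʳ (λ σ → f↑ σ ∙ ∂ʳ f↓ σ) τ  ≈⟨ ∙-congˡ (∂ʳ-∙ f↑ (∂ʳ f↓) τ) ⟩
    ∂ʳ f↑ τ ⁻¹ ∙ (∂ʳ f↑ τ ∙ ∂ʳ (∂ʳ f↓) τ)    ≈⟨ ∙-congˡ (∙-congˡ (∂ʳ∘∂ʳ f↓ τ)) ⟩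
    ∂ʳ f↑ τ ⁻¹ ∙ (∂ʳ f↑ τ ∙ ε)              ≈⟨ ∙-congˡ (identityʳ _) ⟩
    ∂ʳ f↑ τ ⁻¹ ∙ ∂ʳ f↑ τ                    ≈⟨ inverseˡ _ ⟩
    ε                                       ∎
    where
    f↑ f↓ : _ → Carrier
    f↑ = f ∘ (inside ∷_)
    f↓ = f ∘ (outside ∷_)
  ∂ʳ∘∂ʳ f (inside ∷ τ)  =
    ≈-trans (⁻¹-cong (∂ʳ-⁻¹ _ τ)) (≈-trans (⁻¹-involutive _) (∂ʳ∘∂ʳ (f ∘ (inside ∷_)) τ))

  DownClosed : ∀ {n} → (Subset n → Set) → Set
  DownClosed P = ∀ {σ τ} → τ ⊆ σ → P σ → P τ

  ∂ʳ-supported : ∀ {n} {P : Subset n → Set} {f} → DownClosed P → Supported P f → Supported P (∂ʳ f)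
  ∂ʳ-supported P↓ f-supp τ ¬Pτ = ∂ʳ-vanishes τ λ σ (τ⊆σ , _) → f-supp σ (¬Pτ ∘ P↓ τ⊆σ)

  ∂ʳ-homogeneous : ∀ {n j} {f : Subset n → Carrier} → Homogeneous (suc j) f → Homogeneous j (∂ʳ f)
  ∂ʳ-homogeneous f-hom τ ∣τ∣≢j =
    ∂ʳ-vanishes τ λ σ (_ , ∣σ∣≡) → f-hom σ (∣τ∣≢j ∘ suc-injective ∘ trans (sym ∣σ∣≡))

  restrict : ∀ {n} {P : Subset n → Set} → Decidable P → (Subset n → Carrier) → Subset n → Carrier
  restrict P? f σ = if does (P? σ) then f σ else ε

  module _ {n} {P : Subset n → Set} (P? : Decidable P) (f : Subset n → Carrier) where

    restrict-∈ : ∀ {σ} → P σ → restrict P? f σ ≈ f σ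
    restrict-∈ {σ} Pσ with P? σ
    ... | yes _  = ≈-refl
    ... | no ¬Pσ = ⊥-elim (¬Pσ Pσ)

    restrict-∉ : Supported P (restrict P? f)
    restrict-∉ σ ¬Pσ with P? σ
    ... | yes Pσ = ⊥-elim (¬Pσ Pσ)
    ... | no _   = ≈-refl

    restrict-supported : ∀ {Q} → Supported Q f → Supported Q (restrict P? f)
    restrict-supported f-supp σ ¬Qσ with P? σ
    ... | yes _ = f-supp σ ¬Qσ
    ... | no _  = ≈-refl

    restrict-split : ∀ σ → f σ ≈ restrict (¬? ∘ P?) f σ ∙ restrict P? f σ
    restrict-split σ with P? σ
    ... | yes _ = ≈-sym (identityˡ _)
    ... | no _  = ≈-sym (identityʳ _)

  truncate : ∀ {n} → ℕ → (Subset n → Carrier) → Subset n → Carrier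
  truncate j = restrict (λ σ → ∣ σ ∣ ≟ j)

  truncate-∈ : ∀ {n j} (f : Subset n → Carrier) σ → ∣ σ ∣ ≡ j → truncate j f σ ≈ f σ
  truncate-∈ {j = j} f σ = restrict-∈ (λ σ → ∣ σ ∣ ≟ j) f {σ}

  truncate-homogeneous : ∀ {n j} (f : Subset n → Carrier) → Homogeneous j (truncate j f)
  truncate-homogeneous {j = j} f = restrict-∉ (λ σ → ∣ σ ∣ ≟ j) f

  truncate-closed : ∀ {n j} (f : Subset n → Carrier) →
                    (∀ τ → suc ∣ τ ∣ ≡ j → ∂ʳ f τ ≈ ε) → Closed (truncate j f)
  truncate-closed {j = j} f ∂f≈ε τ with suc ∣ τ ∣ ≟ j
  ... | yes ∣τ∣+1≡j = ≈-trans (∂ʳ-cong τ λ σ (_ , ∣σ∣≡) → truncate-∈ f σ (trans ∣σ∣≡ ∣τ∣+1≡j))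
                               (∂f≈ε τ ∣τ∣+1≡j)
  ... | no ∣τ∣+1≢j = ∂ʳ-vanishes τ λ σ (_ , ∣σ∣≡) → truncate-homogeneous f σ (∣τ∣+1≢j ∘ trans (sym ∣σ∣≡))

  cone : ∀ {n} → (Subset (suc n) → Carrier) → Subset (suc n) → Carrier
  cone f (inside ∷ σ)  = f (outside ∷ σ)
  cone f (outside ∷ σ) = ε

  ∂ʳ-cone : ∀ {n} {f : Subset (suc n) → Carrier} → Closed f → ∀ τ → ∂ʳ (cone f) τ ≈ f τ
  ∂ʳ-cone f-closed (outside ∷ τ) = ≈-trans (∙-congˡ (∂ʳ-ε τ)) (identityʳ _)
  ∂ʳ-cone f-closed (inside ∷ τ)  = ≈-sym (inverseˡ-unique _ _ (f-closed (outside ∷ τ)))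

  -- Acyclicity

  record Bounds {n} (P : Subset n → Set) (j : ℕ) (z : Subset n → Carrier) : Set (c ⊔ ℓ) where
    field
      chain       : Subset n → Carrier
      supported   : Supported P chain
      homogeneous : Homogeneous (suc j) chain
      ∂ʳ-chain    : ∀ τ → ∂ʳ chain τ ≈ z τ
  open Bounds

  -- Indexed by size, not dimension: Acyclic P j says that H̃_(j-1) vanishes on the
  -- complex of faces satisfying P.
  Acyclic : ∀ {n} → (Subset n → Set) → ℕ → Set (c ⊔ ℓ)
  Acyclic P j = ∀ z → Supported P z → Homogeneous j z → Closed z → Bounds P j z

  Bounds-mono : ∀ {n j z} {P Q : Subset n → Set} → (∀ {σ} → P σ → Q σ) → Bounds P j z → Bounds Q j z
  Bounds-mono P⇒Q B = record
    { chain       = chain B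
    ; supported   = λ σ ¬Qσ → supported B σ (¬Qσ ∘ P⇒Q)
    ; homogeneous = homogeneous B
    ; ∂ʳ-chain    = ∂ʳ-chain B
    }

  Acyclic-cong : ∀ {n j} {P Q : Subset n → Set} → (∀ {σ} → P σ ⇔ Q σ) → Acyclic P j → Acyclic Q j
  Acyclic-cong P⇔Q P-acyclic z z-supp z-hom z-closed = Bounds-mono (Equivalence.to P⇔Q)
    (P-acyclic z (λ σ ¬Pσ → z-supp σ (¬Pσ ∘ Equivalence.from P⇔Q)) z-hom z-closed)

  empty-acyclic : ∀ {n j} {P : Subset n → Set} → (∀ σ → ¬ P σ) → Acyclic P j
  empty-acyclic ¬P z z-supp _ _ = record
    { chain       = λ _ → ε
    ; supported   = λ _ _ → ≈-refl
    ; homogeneous = λ _ _ → ≈-refl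
    ; ∂ʳ-chain    = λ τ → ≈-trans (∂ʳ-ε τ) (≈-sym (z-supp τ (¬P τ)))
    }

  extendByε : ∀ {n} → (Subset n → Carrier) → Subset (suc n) → Carrier
  extendByε f (inside ∷ σ)  = ε
  extendByε f (outside ∷ σ) = f σ

  simplex-acyclic : ∀ {n} (F : Subset n) → 0 < ∣ F ∣ → ∀ j → Acyclic (_⊆ F) j
  simplex-acyclic (inside ∷ F) _ j z z-supp z-hom z-closed = record
    { chain       = cone z
    ; supported   = λ { (inside ∷ σ) σ⊈F → z-supp (outside ∷ σ) (σ⊈F ∘ s⊆s ∘ drop-∷-⊆)
                      ; (outside ∷ σ) _ → ≈-refl }
    ; homogeneous = λ { (inside ∷ σ) ∣σ∣≢ → z-hom (outside ∷ σ) (∣σ∣≢ ∘ cong suc)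
                      ; (outside ∷ σ) _ → ≈-refl }
    ; ∂ʳ-chain    = ∂ʳ-cone z-closed
    }
  simplex-acyclic (outside ∷ F) 0<∣F∣ j z z-supp z-hom z-closed = record
    { chain       = extendByε (chain B)
    ; supported   = λ { (inside ∷ σ) _ → ≈-refl
                      ; (outside ∷ σ) σ⊈F → supported B σ (σ⊈F ∘ s⊆s) }
    ; homogeneous = λ { (inside ∷ σ) _ → ≈-refl
                      ; (outside ∷ σ) ∣σ∣≢ → homogeneous B σ ∣σ∣≢ }
    ; ∂ʳ-chain    = λ { (outside ∷ τ) → ≈-trans (identityˡ _) (∂ʳ-chain B τ)
                      ; (inside ∷ τ) → ≈-trans (≈ε-⁻¹ (∂ʳ-ε τ)) (≈-sym (z↑≈ε τ)) }
    }
    where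
    z↑≈ε : ∀ σ → z (inside ∷ σ) ≈ ε
    z↑≈ε σ = z-supp (inside ∷ σ) inside⊈outside
    z↓-closed : Closed (z ∘ (outside ∷_))
    z↓-closed τ = ≈-trans (≈-sym (identityˡ _))
                    (≈-trans (∙-congʳ (≈-sym (z↑≈ε τ))) (z-closed (outside ∷ τ)))
    B : Bounds (_⊆ F) j (z ∘ (outside ∷_))
    B = simplex-acyclic F 0<∣F∣ j (z ∘ (outside ∷_)) (λ σ σ⊈F → z-supp (outside ∷ σ) (σ⊈F ∘ drop-∷-⊆))
                        (λ σ → z-hom (outside ∷ σ)) z↓-closed

  Bounds-∙ : ∀ {n j} {P Q : Subset n → Set} {z z₁ z₂} → Bounds P j z₁ → Bounds Q j z₂ →
             (∀ σ → z₁ σ ∙ z₂ σ ≈ z σ) → Bounds (λ σ → P σ ⊎ Q σ) j z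
  Bounds-∙ B₁ B₂ z₁∙z₂≈z = record
    { chain       = λ σ → chain B₁ σ ∙ chain B₂ σ
    ; supported   = λ σ ¬P⊎Q → ≈ε-∙ (supported B₁ σ (¬P⊎Q ∘ inj₁)) (supported B₂ σ (¬P⊎Q ∘ inj₂))
    ; homogeneous = λ σ ∣σ∣≢ → ≈ε-∙ (homogeneous B₁ σ ∣σ∣≢) (homogeneous B₂ σ ∣σ∣≢)
    ; ∂ʳ-chain    = λ τ → ≈-trans (∂ʳ-∙ (chain B₁) (chain B₂) τ)
                            (≈-trans (∙-cong (∂ʳ-chain B₁ τ) (∂ʳ-chain B₂ τ)) (z₁∙z₂≈z τ))
    }

  ∂ʳ-split-supported : ∀ {n} {P Q : Subset n → Set} {zP zQ} → DownClosed P → DownClosed Q → Decidable Q →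
                       Supported P zP → Supported Q zQ → (∀ τ → ∂ʳ zP τ ∙ ∂ʳ zQ τ ≈ ε) →
                       Supported (λ σ → P σ × Q σ) (∂ʳ zP)
  ∂ʳ-split-supported P↓ Q↓ Q? zP-supp zQ-supp ∂zP∙∂zQ≈ε σ ¬P×Q with Q? σ
  ... | yes Qσ = ∂ʳ-supported P↓ zP-supp σ (λ Pσ → ¬P×Q (Pσ , Qσ))
  ... | no ¬Qσ = ≈-trans (inverseˡ-unique _ _ (∂zP∙∂zQ≈ε σ)) (≈ε-⁻¹ (∂ʳ-supported Q↓ zQ-supp σ ¬Qσ))

  -- A cycle on P ∪ Q splits as zP ∙ zQ along Q; the common boundary ∂ʳ zP lives on
  -- P ∩ Q and bounds some w there, and then zP ∙ w⁻¹ and zQ ∙ w are cycles on P and Q.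
  mayer-vietoris : ∀ {n j} {P Q : Subset n → Set} → DownClosed P → DownClosed Q → Decidable Q →
                   Acyclic P (suc j) → Acyclic Q (suc j) → Acyclic (λ σ → P σ × Q σ) j →
                   Acyclic (λ σ → P σ ⊎ Q σ) (suc j)
  mayer-vietoris {n} {j} {P} {Q} P↓ Q↓ Q? P-acyclic Q-acyclic P∩Q-acyclic z z-supp z-hom z-closed =
    Bounds-∙ (P-acyclic z₁ z₁-supp z₁-hom z₁-closed) (Q-acyclic z₂ z₂-supp z₂-hom z₂-closed) z₁∙z₂≈z
    where
    zP zQ : Subset n → Carrier
    zP = restrict (¬? ∘ Q?) z
    zQ = restrict Q? z
    zP-supp : Supported P zP
    zP-supp σ ¬Pσ with Q? σ
    ... | yes _  = ≈-refl
    ... | no ¬Qσ = z-supp σ [ ¬Pσ , ¬Qσ ]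
    ∂zP∙∂zQ≈ε : ∀ τ → ∂ʳ zP τ ∙ ∂ʳ zQ τ ≈ ε
    ∂zP∙∂zQ≈ε τ = ≈-trans (≈-sym (∂ʳ-∙ zP zQ τ))
                    (≈-trans (∂ʳ-cong τ λ σ _ → ≈-sym (restrict-split Q? z σ)) (z-closed τ))
    W : Bounds (λ σ → P σ × Q σ) j (∂ʳ zP)
    W = P∩Q-acyclic (∂ʳ zP) (∂ʳ-split-supported P↓ Q↓ Q? zP-supp (restrict-∉ Q? z) ∂zP∙∂zQ≈ε)
          (∂ʳ-homogeneous (restrict-supported (¬? ∘ Q?) z z-hom)) (∂ʳ∘∂ʳ zP)
    w = chain W
    z₁ z₂ : Subset n → Carrier
    z₁ σ = zP σ ∙ w σ ⁻¹
    z₂ σ = zQ σ ∙ w σ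
    z₁-supp : Supported P z₁
    z₁-supp σ ¬Pσ = ≈ε-∙ (zP-supp σ ¬Pσ) (≈ε-⁻¹ (supported W σ (¬Pσ ∘ proj₁)))
    z₂-supp : Supported Q z₂
    z₂-supp σ ¬Qσ = ≈ε-∙ (restrict-∉ Q? z σ ¬Qσ) (supported W σ (¬Qσ ∘ proj₂))
    z₁-hom : Homogeneous (suc j) z₁
    z₁-hom σ ∣σ∣≢ = ≈ε-∙ (restrict-supported (¬? ∘ Q?) z z-hom σ ∣σ∣≢) (≈ε-⁻¹ (homogeneous W σ ∣σ∣≢))
    z₂-hom : Homogeneous (suc j) z₂
    z₂-hom σ ∣σ∣≢ = ≈ε-∙ (restrict-supported Q? z z-hom σ ∣σ∣≢) (homogeneous W σ ∣σ∣≢)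
    z₁-closed : Closed z₁
    z₁-closed τ = begin
      ∂ʳ z₁ τ                      ≈⟨ ∂ʳ-∙ zP (λ σ → w σ ⁻¹) τ ⟩
      ∂ʳ zP τ ∙ ∂ʳ (λ σ → w σ ⁻¹) τ  ≈⟨ ∙-congˡ (≈-trans (∂ʳ-⁻¹ w τ) (⁻¹-cong (∂ʳ-chain W τ))) ⟩
      ∂ʳ zP τ ∙ ∂ʳ zP τ ⁻¹          ≈⟨ inverseʳ _ ⟩
      ε                            ∎
    z₂-closed : Closed z₂
    z₂-closed τ = begin
      ∂ʳ z₂ τ             ≈⟨ ∂ʳ-∙ zQ w τ ⟩
      ∂ʳ zQ τ ∙ ∂ʳ w τ    ≈⟨ ∙-congˡ (∂ʳ-chain W τ) ⟩
      ∂ʳ zQ τ ∙ ∂ʳ zP τ   ≈⟨ comm _ _ ⟩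
      ∂ʳ zP τ ∙ ∂ʳ zQ τ   ≈⟨ ∂zP∙∂zQ≈ε τ ⟩
      ε                   ∎
    z₁∙z₂≈z : ∀ σ → z₁ σ ∙ z₂ σ ≈ z σ
    z₁∙z₂≈z σ = begin
      (zP σ ∙ w σ ⁻¹) ∙ (zQ σ ∙ w σ)  ≈⟨ interchange _ _ _ _ ⟩
      (zP σ ∙ zQ σ) ∙ (w σ ⁻¹ ∙ w σ)  ≈⟨ ∙-congˡ (inverseˡ _) ⟩
      (zP σ ∙ zQ σ) ∙ ε               ≈⟨ identityʳ _ ⟩
      zP σ ∙ zQ σ                     ≈⟨ ≈-sym (restrict-split Q? z σ) ⟩
      z σ                             ∎

  -- The lower bound

  generated-acyclic : ∀ {n} j m (V : Subset n) Fs →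
                      All (MissesAtMost m V) Fs → suc j * m < ∣ V ∣ → Acyclic (Generated Fs) j
  generated-acyclic j m V [] _ _ = empty-acyclic λ _ ()
  generated-acyclic zero m V (F ∷ Fs) (F-misses ∷ _) m<∣V∣ z z-supp z-hom z-closed =
    Bounds-mono here (simplex-acyclic F (MissesAtMost⇒< F-misses m<∣V∣) 0 z
      (λ σ σ⊈F → z-hom σ (σ⊈F ∘ ∣p∣≡0⇒p⊆q)) z-hom z-closed)
  generated-acyclic (suc j) m V (F ∷ Fs) (F-misses ∷ Fs-misses) [2+j]m<∣V∣ =
    Acyclic-cong Generated-∷
      (mayer-vietoris {P = _⊆ F} (λ τ⊆σ σ⊆F → ⊆-trans τ⊆σ σ⊆F) Generated-downClosed (generated? Fs)
        (simplex-acyclic F (≤-trans (s≤s z≤n) [1+j]m<∣F∣) (suc j))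
        (generated-acyclic (suc j) m V Fs Fs-misses [2+j]m<∣V∣)
        (Acyclic-cong (Generated-map-∩ F Fs)
          (generated-acyclic j m F (map (F ∩_) Fs) F∩Fs-miss [1+j]m<∣F∣)))
    where
    F∩Fs-miss : All (MissesAtMost m F) (map (F ∩_) Fs)
    F∩Fs-miss = Allᵖ.map⁺ (All.map (MissesAtMost-∩ F-misses) Fs-misses)
    [1+j]m<∣F∣ : suc j * m < ∣ F ∣
    [1+j]m<∣F∣ = MissesAtMost⇒< F-misses [2+j]m<∣V∣

  pure-acyclic : ∀ {n} d k (X : Complex n) → (∀ σ → Dec (face X σ)) → Pure d X →
                 n * suc k < (d + 1) * (k + 2) → Acyclic (face X) (suc k)
  pure-acyclic {n} d k X face? pure few-vertices =
    Acyclic-cong (facets-generate X face? pure) (facets-acyclic _ (facets-size X face? (suc d)))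
    where
    facets-acyclic : ∀ Fs → All (λ F → ∣ F ∣ ≡ suc d) Fs → Acyclic (Generated Fs) (suc k)
    facets-acyclic [] _ = empty-acyclic λ _ ()
    facets-acyclic (F ∷ Fs) sizes@(∣F∣≡1+d ∷ _) =
      generated-acyclic (suc k) (n ∸ suc d) ⊤ (F ∷ Fs) (All.map MissesAtMost-⊤ sizes)
        (subst (suc (suc k) * (n ∸ suc d) <_) (trans n≡ (sym (∣⊤∣≡n n)))
          (small-codimension d k (n ∸ suc d) (subst (λ x → x * suc k < _) (sym n≡) few-vertices)))
      where
      n≡ : suc d + (n ∸ suc d) ≡ n
      n≡ = m+[n∸m]≡n (subst (_≤ n) ∣F∣≡1+d (∣p∣≤n F))

  acyclic⇒boundary : ∀ {n k} (X : Complex n) → Acyclic (face X) (suc k) →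
                     (z : Chain X) → IsCycle X k z → IsBoundary X k z
  acyclic⇒boundary {k = k} X X-acyclic (z , z-supp) z-cycle =
    (chain B , supported B) , λ σ ∣σ∣≡1+k → begin
      z σ                   ≈⟨ truncate-∈ z σ ∣σ∣≡1+k ⟨
      truncate (suc k) z σ  ≈⟨ ∂ʳ-chain B σ ⟨
      ∂ʳ (chain B) σ        ≈⟨ ∂≈∂ʳ (chain B) σ ⟨
      ∂ (chain B) σ         ∎
    where
    B : Bounds (face X) (suc k) (truncate (suc k) z)
    B = X-acyclic (truncate (suc k) z) (restrict-supported (λ σ → ∣ σ ∣ ≟ suc k) z z-supp)
          (truncate-homogeneous z)
          (truncate-closed z λ τ ∣τ∣+1≡ → ≈-trans (≈-sym (∂≈∂ʳ z τ)) (z-cycle τ (suc-injective ∣τ∣+1≡)))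

  lower-bound : ∀ d k {n} (X : Complex n) → Pure d X → NontrivialH X k →
                ceilDiv ((d + 1) * (k + 2)) k ≤ n
  lower-bound d k {n} X pure (z , z-cycle , z-not-boundary) with ceilDiv ((d + 1) * (k + 2)) k ≤? n
  ... | yes bound = bound
  -- Faces of X need not be decidable, but the goal is a negation, so we may
  -- assume they are.
  ... | no ¬bound = ⊥-elim (¬¬-decidable (face X) λ face? →
        z-not-boundary (acyclic⇒boundary X (pure-acyclic d k X face? pure few-vertices) z z-cycle))
    where
    few-vertices : n * suc k < (d + 1) * (k + 2)
    few-vertices = ≰⇒> (¬bound ∘ ceilDiv-least _ k n)

  -- The construction

  elementary : ∀ {n} → Subset n → Carrier → Subset n → Carrier
  elementary T g σ = if does (σ ≟ˢ T) then g else ε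

  -- Pushes a chain forward along the map sending the first vertex onto the second,
  -- on faces with L + 1 vertices: the part through the first vertex is coned off
  -- from the second one.
  collapse : ∀ {n} → ℕ → (Subset (suc (suc n)) → Carrier) → Subset (suc n) → Carrier
  collapse L b σ = cone (truncate L (b ∘ (inside ∷_))) σ ∙ b (outside ∷ σ)

  ∂ʳ-collapse : ∀ {n L} (b : Subset (suc (suc n)) → Carrier) →
                (∀ τ → suc ∣ τ ∣ ≡ L → ∂ʳ (b ∘ (inside ∷_)) τ ≈ ε) →
                ∀ ρ → ∣ ρ ∣ ≡ L → ∂ʳ (collapse L b) ρ ≈ ∂ʳ b (outside ∷ ρ)
  ∂ʳ-collapse {L = L} b ∂b↑≈ε ρ ∣ρ∣≡L = begin
    ∂ʳ (collapse L b) ρ                             ≈⟨ ∂ʳ-∙ (cone b↑) (b ∘ (outside ∷_)) ρ ⟩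
    ∂ʳ (cone b↑) ρ ∙ ∂ʳ (b ∘ (outside ∷_)) ρ        ≈⟨ ∙-congʳ (∂ʳ-cone (truncate-closed _ ∂b↑≈ε) ρ) ⟩
    b↑ ρ ∙ ∂ʳ (b ∘ (outside ∷_)) ρ                  ≈⟨ ∙-congʳ (truncate-∈ (b ∘ (inside ∷_)) ρ ∣ρ∣≡L) ⟩
    b (inside ∷ ρ) ∙ ∂ʳ (b ∘ (outside ∷_)) ρ        ∎
    where
    b↑ = truncate L (b ∘ (inside ∷_))

  -- Induction on the blocks: a first block of size one is removed by passing to
  -- the link of its vertex, a larger one shrinks by collapsing its first vertex
  -- onto the second; one block of size one is left, where ∂ of the vertex is g.
  transversal-not-bounding : ∀ {g} → ¬ g ≈ ε → ∀ a as (b : Subset (total (a ∷ as)) → Carrier) →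
    (∀ σ → ∣ σ ∣ ≡ suc (length as) → ¬ Generated (avoiders (a ∷ as)) σ → b σ ≈ ε) →
    ¬ (∀ τ → ∣ τ ∣ ≡ length as → ∂ʳ (elementary (transversal (a ∷ as)) g) τ ≈ ∂ʳ b τ)
  transversal-not-bounding {g} g≉ε zero [] b b-supp ∂T≈∂b =
    g≉ε (≈-trans (≈-sym (identityʳ g)) (≈-trans (∂T≈∂b (outside ∷ []) refl)
      (≈ε-∙ (b-supp (inside ∷ []) refl λ { (here ⊆W) → inside⊈outside ⊆W }) ≈-refl)))
  transversal-not-bounding g≉ε zero (a ∷ as) b b-supp ∂T≈∂b =
    transversal-not-bounding g≉ε a as (b ∘ (inside ∷_))
      (λ σ ∣σ∣≡ σ∉ → b-supp (inside ∷ σ) (cong suc ∣σ∣≡) (σ∉ ∘ Equivalence.to Generated-avoiders-link))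
      (λ τ ∣τ∣≡ → ⁻¹-injective (∂T≈∂b (inside ∷ τ) (cong suc ∣τ∣≡)))
  transversal-not-bounding g≉ε (suc a) as b b-supp ∂T≈∂b =
    transversal-not-bounding g≉ε a as (collapse (length as) b) collapse-supp
      (λ ρ ∣ρ∣≡ → ≈-trans (≈-trans (≈-sym (identityˡ _)) (∂T≈∂b (outside ∷ ρ) ∣ρ∣≡))
                          (≈-sym (∂ʳ-collapse b ∂b↑≈ε ρ ∣ρ∣≡)))
    where
    ∂b↑≈ε : ∀ τ → suc ∣ τ ∣ ≡ length as → ∂ʳ (b ∘ (inside ∷_)) τ ≈ ε
    ∂b↑≈ε τ ∣τ∣+1≡ = ≈-trans (≈-sym (⁻¹-injective (∂T≈∂b (inside ∷ τ) ∣τ∣+1≡))) (∂ʳ-ε τ)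
    collapse-supp : ∀ σ → ∣ σ ∣ ≡ suc (length as) → ¬ Generated (avoiders (a ∷ as)) σ →
                    collapse (length as) b σ ≈ ε
    collapse-supp (outside ∷ ρ) ∣ρ∣≡ σ∉ =
      ≈ε-∙ ≈-refl (b-supp (outside ∷ outside ∷ ρ) ∣ρ∣≡ (σ∉ ∘ Generated-avoiders-tail))
    collapse-supp (inside ∷ ρ) ∣ρ∣+1≡ σ∉ = ≈ε-∙
      (≈-trans (truncate-∈ (b ∘ (inside ∷_)) (outside ∷ ρ) (suc-injective ∣ρ∣+1≡))
               (b-supp (inside ∷ outside ∷ ρ) ∣ρ∣+1≡ (σ∉ ∘ Generated-avoiders-merge)))
      (b-supp (outside ∷ inside ∷ ρ) ∣ρ∣+1≡ (σ∉ ∘ Generated-avoiders-tail))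

  block-complex-nontrivial : ∀ {d k g} → k ≤ d → ¬ g ≈ ε → ∀ as → length as ≡ suc (suc k) →
                             NontrivialH (BlockComplex (suc d) as) k
  block-complex-nontrivial {d} {k} {g} k≤d g≉ε (a ∷ as) len = (z , z-supp) , z-cycle , z-not-boundary
    where
    T = transversal (a ∷ as)
    X = BlockComplex (suc d) (a ∷ as)
    z : Subset (total (a ∷ as)) → Carrier
    z = ∂ʳ (elementary T g)
    z-supp : Supported (face X) z
    z-supp σ σ∉X = ∂ʳ-vanishes σ vanish
      where
      vanish : ∀ ρ → σ ⋖ ρ → elementary T g ρ ≈ ε
      vanish ρ σ⋖ρ with ρ ≟ˢ T
      ... | no _     = ≈-refl
      ... | yes refl = ⊥-elim (σ∉X (∣σ∣≤1+d , transversal-faces a as σ⋖ρ))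
        where
        ∣σ∣≤1+d : ∣ σ ∣ ≤ suc d
        ∣σ∣≤1+d = subst (_≤ suc d) (sym (suc-injective 1+∣σ∣≡2+k)) (s≤s k≤d)
          where
          1+∣σ∣≡2+k : suc ∣ σ ∣ ≡ suc (suc k)
          1+∣σ∣≡2+k = trans (sym (proj₂ σ⋖ρ)) (trans (∣transversal∣ (a ∷ as)) len)
    z-cycle : IsCycle X k (z , z-supp)
    z-cycle τ _ = ≈-trans (∂≈∂ʳ z τ) (∂ʳ∘∂ʳ (elementary T g) τ)
    z-not-boundary : ¬ IsBoundary X k (z , z-supp)
    z-not-boundary ((b , b-supp) , z≈∂b) = transversal-not-bounding g≉ε a as b
      (λ σ _ σ∉ → b-supp σ (σ∉ ∘ proj₂))
      (λ τ ∣τ∣≡ → ≈-trans (z≈∂b τ (trans ∣τ∣≡ (suc-injective len))) (∂≈∂ʳ b τ))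

theorem1 : ∀ {c ℓ : Level} (d k : ℕ) → k ≤ d →
    ((G : AbelianGroup c ℓ) (n : ℕ) (X : Complex n) →
      Pure d X → Homology.NontrivialH G X k →
      ceilDiv ((d + 1) * (k + 2)) k ≤ n)
    ×
    ((G : AbelianGroup c ℓ) →
      (∃ λ g → ¬ AbelianGroup._≈_ G g (AbelianGroup.ε G)) →
      Σ ℕ λ n → Σ (Complex n) λ X →
        Pure d X × Homology.NontrivialH G X k × n ≡ ceilDiv ((d + 1) * (k + 2)) k)
theorem1 d k k≤d =
  (λ G n X pure nontrivial → lower-bound G d k X pure nontrivial) ,
  λ G (g , g≉ε) →
    let as , len , total≡ , avoiders-fit = block-partition d k _ k≤d (ceilDiv-spec _ k)
    in total as , BlockComplex (suc d) as , block-complex-pure as avoiders-fit ,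
       block-complex-nontrivial G k≤d g≉ε as len , total≡
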